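{- Let $F_{n,m}$ denote the number of Cayley trees of size $n$ with exactly $m$ ascending runs and $R_{n,m}$ the number of $n$-mappings with exactly $m$ ascending runs. Then for all $n \ge 1$ and $m \ge 1$, $R_{n,m} = n \cdot F_{n,m}$.
   Context: A Cayley tree of size $n$ is an unordered rooted tree on $n$ nodes labelled by distinct elements of $[n]=\{1,\dots,n\}$, with edges oriented from child to parent (towards the root). An $n$-mapping is a function $f:[n]\to[n]$. An ascending run in an $n$-mapping $f$ is a maximal ascending sequence $i < f(i) < f^2(i) < \dots < f^k(i)$ (not contained in a longer such sequence); the number of ascending runs of $f$ equals the number of elements $j\in[n]$ such that every $i$ with $f(i)=j$ satisfies $i \ge j$. Analogously, an ascending run in a Cayley tree is a maximal path (following edges towards the root) along which labels increase, and the number of ascending runs of a tree equals the number of nodes $v$ all of whose children have labels larger than $v$. -}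

module Defs where

open import Data.Nat using (ℕ; zero; suc; _≟_)
open import Data.Fin using (Fin; toℕ)
open import Data.Fin.Properties using (all?)
open import Data.Maybe using (Maybe; nothing; just)
open import Data.List using (List; []; _∷_; map; concatMap; filter; length; allFin)
open import Data.Vec.Functional using () renaming (_∷_ to _∷ᶠ_)
open import Relation.Binary.PropositionalEquality using (_≡_)
open import Relation.Nullary using (Dec; yes; no; ¬_)
open import Relation.Nullary.Decidable using (_→-dec_; _×-dec_)
open import Data.Product using (_×_)
import Data.Nat as ℕ
import Data.Maybe.Properties as MaybeP
import Data.Fin.Properties as FinP

allFuns : {A : Set} → List A → (n : ℕ) → List (Fin n → A)
allFuns xs zero = (λ ()) ∷ []
allFuns xs (suc n) = concatMap (λ a → map (λ f → a ∷ᶠ f) (allFuns xs n)) xs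

-- n-mappings: functions f : [n] → [n], with [n] represented by Fin n
-- (label i+1 ↔ toℕ i = i; the order is preserved).

Mapping : ℕ → Set
Mapping n = Fin n → Fin n

allMappings : (n : ℕ) → List (Mapping n)
allMappings n = allFuns (allFin n) n

RunStartM : {n : ℕ} → Mapping n → Fin n → Set
RunStartM {n} f j = (i : Fin n) → f i ≡ j → toℕ j ℕ.≤ toℕ i

runStartM? : {n : ℕ} (f : Mapping n) (j : Fin n) → Dec (RunStartM f j)
runStartM? f j = all? (λ i → (f i FinP.≟ j) →-dec (toℕ j ℕ.≤? toℕ i))

runsM : {n : ℕ} → Mapping n → ℕ
runsM {n} f = length (filter (runStartM? f) (allFin n))

-- Cayley trees of size n: given by the parent function
-- (edges child → parent), the root having parent 'nothing'.

ParentFn : ℕ → Set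
ParentFn n = Fin n → Maybe (Fin n)

climb : {n : ℕ} → ParentFn n → ℕ → Maybe (Fin n) → Maybe (Fin n)
climb p zero x = x
climb p (suc k) nothing = nothing
climb p (suc k) (just v) = climb p k (p v)

IsRoot : {n : ℕ} → ParentFn n → Fin n → Set
IsRoot p v = p v ≡ nothing

isRoot? : {n : ℕ} (p : ParentFn n) (v : Fin n) → Dec (IsRoot p v)
isRoot? p v = MaybeP.≡-dec FinP._≟_ (p v) nothing

numRoots : {n : ℕ} → ParentFn n → ℕ
numRoots {n} p = length (filter (isRoot? p) (allFin n))

Acyclic : {n : ℕ} → ParentFn n → Set
Acyclic {n} p = (v : Fin n) → climb p n (just v) ≡ nothing

acyclic? : {n : ℕ} (p : ParentFn n) → Dec (Acyclic p)
acyclic? {n} p = all? (λ v → MaybeP.≡-dec FinP._≟_ (climb p n (just v)) nothing)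

IsCayleyTree : {n : ℕ} → ParentFn n → Set
IsCayleyTree p = Acyclic p × (numRoots p ≡ 1)

isCayleyTree? : {n : ℕ} (p : ParentFn n) → Dec (IsCayleyTree p)
isCayleyTree? p = acyclic? p ×-dec (numRoots p ≟ 1)

allParentFns : (n : ℕ) → List (ParentFn n)
allParentFns n = allFuns (nothing ∷ map just (allFin n)) n

cayleyTrees : (n : ℕ) → List (ParentFn n)
cayleyTrees n = filter isCayleyTree? (allParentFns n)

RunStartT : {n : ℕ} → ParentFn n → Fin n → Set
RunStartT {n} p v = (u : Fin n) → p u ≡ just v → toℕ v ℕ.< toℕ u

runStartT? : {n : ℕ} (p : ParentFn n) (v : Fin n) → Dec (RunStartT p v)
runStartT? p v = all? (λ u → MaybeP.≡-dec FinP._≟_ (p u) (just v) →-dec (toℕ v ℕ.<? toℕ u))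

runsT : {n : ℕ} → ParentFn n → ℕ
runsT {n} p = length (filter (runStartT? p) (allFin n))

F : ℕ → ℕ → ℕ
F n m = length (filter (λ p → runsT p ≟ m) (cayleyTrees n))

R : ℕ → ℕ → ℕ
R n m = length (filter (λ f → runsM f ≟ m) (allMappings n))

module Submission where

open import Defs
open import Data.Nat using (ℕ; suc; _*_; _≥_)
open import Data.Fin using (Fin)
open import Relation.Binary.PropositionalEquality using (_≡_)

-- R n m = n · F n m: the n-mappings with m ascending runs are in bijection
-- with the pairs (v, T) of a node v ∈ [n] and a Cayley tree T with m runs.
--
-- Given f, let c₁ < … < cₖ be the minima of its cycles.  Cutting every cycle
-- just before its minimum cᵢ and attaching the cut-off end to cᵢ₋₁ (for c₁ it
-- becomes the root) turns f into a Cayley tree, marked at cₖ.  Conversely the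
-- path from the marked node v to the root splits at its left-to-right minima
-- into segments, and gluing closes each segment into a cycle again.  Cutting
-- keeps the nodes all of whose preimages/children are larger, so it preserves
-- the number of ascending runs.

module Counting where

  open import Data.Nat using (suc; _+_; _≤_; z≤n; s≤s)
  open import Data.Nat.Properties using (≤-antisym)
  open import Data.List using (List; []; _∷_; map; filter; length; cartesianProduct; allFin)
  open import Data.List.Properties using (length-removeAt′; length-++; length-map)
  open import Data.List.Membership.Propositional using (_∈_; _─_)
  open import Data.List.Membership.Propositional.Properties using (∈-filter⁺; ∈-filter⁻; ∈-allFin)
  open import Data.List.Relation.Unary.Any using (here; there)
  import Data.List.Relation.Unary.All as All
  open All using ([])
  open import Data.List.Relation.Unary.AllPairs using ([]; _∷_)
  open import Data.List.Relation.Unary.Unique.Propositional using (Unique)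
  import Data.List.Relation.Unary.Unique.Propositional.Properties as Unique
  open import Data.Product using (Σ; _×_; _,_; proj₂)
  open import Data.Fin using (Fin)
  open import Relation.Unary using (Pred; Decidable)
  open import Level using (0ℓ)
  open import Relation.Binary.PropositionalEquality using (_≢_; refl; sym; trans; cong; cong₂; subst)
  open import Data.Empty using (⊥-elim)

  ∈-─ : {A : Set} {x y : A} {ys : List A} (x∈ys : x ∈ ys) → y ∈ ys → y ≢ x → y ∈ ys ─ x∈ys
  ∈-─ (here refl) (here refl) y≢x = ⊥-elim (y≢x refl)
  ∈-─ (here refl) (there y∈ys) _  = y∈ys
  ∈-─ (there _)   (here refl) _   = here refl
  ∈-─ (there x∈ys) (there y∈ys) y≢x = there (∈-─ x∈ys y∈ys y≢x)

  injection-length≤ : {A B : Set} {xs : List A} {ys : List B} (Φ : A → B) → Unique xs →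
    (∀ {a b} → a ∈ xs → b ∈ xs → Φ a ≡ Φ b → a ≡ b) → (∀ {a} → a ∈ xs → Φ a ∈ ys) →
    length xs ≤ length ys
  injection-length≤ {xs = []} Φ _ _ _ = z≤n
  injection-length≤ {xs = x ∷ xs} {ys} Φ (x∉xs ∷ unique) inj into =
    subst (suc (length xs) ≤_) (sym (length-removeAt′ ys _))
      (s≤s (injection-length≤ Φ unique (λ a b → inj (there a) (there b)) into-rest))
    where
    into-rest : ∀ {a} → a ∈ xs → Φ a ∈ ys ─ into (here refl)
    into-rest a∈xs = ∈-─ (into (here refl)) (into (there a∈xs))
      (λ Φa≡Φx → All.lookup x∉xs a∈xs (inj (here refl) (there a∈xs) (sym Φa≡Φx)))

  bijection-length : {A B : Set} {xs : List A} {ys : List B} → Unique xs → Unique ys →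
    (Φ : A → B) (Ψ : B → A) → (∀ {a} → a ∈ xs → Φ a ∈ ys) → (∀ {b} → b ∈ ys → Ψ b ∈ xs) →
    (∀ {a} → a ∈ xs → Ψ (Φ a) ≡ a) → (∀ {b} → b ∈ ys → Φ (Ψ b) ≡ b) →
    length xs ≡ length ys
  bijection-length uxs uys Φ Ψ Φ∈ Ψ∈ ΨΦ ΦΨ = ≤-antisym
    (injection-length≤ Φ uxs (λ a b e → trans (sym (ΨΦ a)) (trans (cong Ψ e) (ΨΦ b))) Φ∈)
    (injection-length≤ Ψ uys (λ a b e → trans (sym (ΦΨ a)) (trans (cong Φ e) (ΦΨ b))) Ψ∈)

  filter-bijection-length : {A B : Set} {P : Pred A 0ℓ} (P? : Decidable P) {xs : List A} {ys : List B} →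
    Unique xs → (∀ a → a ∈ xs) → Unique ys → (Φ : A → B) (Ψ : B → A) →
    (∀ {a} → P a → Φ a ∈ ys) → (∀ {b} → b ∈ ys → P (Ψ b)) →
    (∀ {a} → P a → Ψ (Φ a) ≡ a) → (∀ {b} → b ∈ ys → Φ (Ψ b) ≡ b) →
    length (filter P? xs) ≡ length ys
  filter-bijection-length P? {xs} uxs complete uys Φ Ψ Φ∈ PΨ ΨΦ ΦΨ =
    bijection-length (Unique.filter⁺ P? uxs) uys Φ Ψ
      (λ a∈ → Φ∈ (proj₂ (∈-filter⁻ P? {xs = xs} a∈)))
      (λ b∈ → ∈-filter⁺ P? (complete _) (PΨ b∈))
      (λ a∈ → ΨΦ (proj₂ (∈-filter⁻ P? {xs = xs} a∈)))
      ΦΨ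

  length-cartesianProduct : {A B : Set} (xs : List A) (ys : List B) →
    length (cartesianProduct xs ys) ≡ length xs * length ys
  length-cartesianProduct [] ys = refl
  length-cartesianProduct (x ∷ xs) ys =
    trans (length-++ (map (x ,_) ys))
      (cong₂ _+_ (length-map (x ,_) ys) (length-cartesianProduct xs ys))

  module _ {n : ℕ} {P : Pred (Fin n) 0ℓ} (P? : Decidable P) where

    count-one : (r : Fin n) → P r → (∀ y → P y → y ≡ r) → length (filter P? (allFin n)) ≡ 1
    count-one r Pr unique = filter-bijection-length P? (Unique.allFin⁺ n) ∈-allFin ([] ∷ [])
      (λ y → y) (λ y → y) (λ Py → here (unique _ Py)) (λ { (here refl) → Pr }) (λ _ → refl) (λ _ → refl)

    count-one⁻ : length (filter P? (allFin n)) ≡ 1 → Σ (Fin n) λ r → P r × (∀ y → P y → y ≡ r)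
    count-one⁻ one with filter P? (allFin n) in eq
    ... | r ∷ [] = r , satisfies (here refl) , λ y Py → only (∈-filter⁺ P? (∈-allFin y) Py)
      where
      satisfies : ∀ {y} → y ∈ r ∷ [] → P y
      satisfies y∈ = proj₂ (∈-filter⁻ P? {xs = allFin n} (subst (_ ∈_) (sym eq) y∈))
      only : ∀ {y} → y ∈ filter P? (allFin n) → y ≡ r
      only y∈ with subst (_ ∈_) eq y∈
      ... | here y≡r = y≡r

-- Functions Fin n → A carry no decidable equality, so enumerations of them
-- cannot be shown duplicate-free directly; we enumerate vectors instead and
-- relate the two enumerations entrywise.
module Enumeration where

  open import Data.Nat using (zero; suc)
  open import Data.Fin using (Fin; zero; suc)
  open import Data.Maybe using (Maybe; nothing; just)
  open import Data.Maybe.Properties using (just-injective)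
  open import Data.Vec using (Vec; []; _∷_; lookup)
  open import Data.Vec.Properties using (∷-injective)
  open import Data.Vec.Functional using () renaming (_∷_ to _∷ᶠ_)
  open import Data.List using (List; []; _∷_; map; concatMap; allFin; cartesianProductWith)
  open import Data.List.Membership.Propositional using (_∈_)
  open import Data.List.Membership.Propositional.Properties
    using (∈-map⁺; ∈-allFin; ∈-cartesianProductWith⁺)
  open import Data.List.Relation.Unary.Any using (here; there)
  open import Data.List.Relation.Unary.All using (All; []; _∷_)
  open import Data.List.Relation.Unary.AllPairs using ([]; _∷_)
  open import Data.List.Relation.Unary.Unique.Propositional using (Unique)
  import Data.List.Relation.Unary.Unique.Propositional.Properties as Unique
  open import Data.List.Relation.Binary.Pointwise as Pointwise using (Pointwise; []; _∷_)
  open import Relation.Binary.PropositionalEquality using (_≢_; refl)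

  allVecs : {A : Set} → List A → (n : ℕ) → List (Vec A n)
  allVecs xs zero = [] ∷ []
  allVecs xs (suc n) = cartesianProductWith _∷_ xs (allVecs xs n)

  _≗ᵛ_ : {A : Set} {n : ℕ} → (Fin n → A) → Vec A n → Set
  f ≗ᵛ v = ∀ i → f i ≡ lookup v i

  allFuns≗allVecs : {A : Set} (xs : List A) (n : ℕ) → Pointwise _≗ᵛ_ (allFuns xs n) (allVecs xs n)
  allFuns≗allVecs xs zero = (λ ()) ∷ []
  allFuns≗allVecs xs (suc n) = prepend xs
    where
    prepend : ∀ ys → Pointwise _≗ᵛ_ (concatMap (λ a → map (a ∷ᶠ_) (allFuns xs n)) ys)
                                     (cartesianProductWith _∷_ ys (allVecs xs n))
    prepend [] = []
    prepend (a ∷ ys) = Pointwise.++⁺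
      (Pointwise.map⁺ (a ∷ᶠ_) (a ∷_) (Pointwise.map (λ f≗v → λ { zero → refl ; (suc i) → f≗v i })
        (allFuns≗allVecs xs n)))
      (prepend ys)

  allVecs-complete : {A : Set} {xs : List A} → (∀ a → a ∈ xs) → ∀ {n} (v : Vec A n) → v ∈ allVecs xs n
  allVecs-complete complete [] = here refl
  allVecs-complete complete (a ∷ v) =
    ∈-cartesianProductWith⁺ _∷_ (complete a) (allVecs-complete complete v)

  allVecs-unique : {A : Set} {xs : List A} → Unique xs → ∀ n → Unique (allVecs xs n)
  allVecs-unique unique zero = [] ∷ []
  allVecs-unique unique (suc n) =
    Unique.cartesianProductWith⁺ _∷_ ∷-injective unique (allVecs-unique unique n)

  parentChoices : (n : ℕ) → List (Maybe (Fin n))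
  parentChoices n = nothing ∷ map just (allFin n)

  parentChoices-complete : ∀ {n} (a : Maybe (Fin n)) → a ∈ parentChoices n
  parentChoices-complete nothing = here refl
  parentChoices-complete (just x) = there (∈-map⁺ just (∈-allFin x))

  parentChoices-unique : ∀ n → Unique (parentChoices n)
  parentChoices-unique n = nothing∉ (allFin n) ∷ Unique.map⁺ just-injective (Unique.allFin⁺ n)
    where
    nothing∉ : (xs : List (Fin n)) → All (nothing ≢_) (map just xs)
    nothing∉ [] = []
    nothing∉ (x ∷ xs) = (λ ()) ∷ nothing∉ xs

module Congruence where

  open import Data.Nat using (zero; suc)
  open import Data.Maybe using (just; nothing)
  open import Data.List using (length; allFin)
  open import Data.List.Properties using (filter-≐)
  open import Data.Product using (_,_)
  open import Relation.Binary.PropositionalEquality using (refl; sym; trans; cong; _≗_)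

  runsM-cong : ∀ {n} {f g : Mapping n} → f ≗ g → runsM f ≡ runsM g
  runsM-cong {n} {f} {g} f≗g = cong length (filter-≐ (runStartM? f) (runStartM? g)
    ( (λ start i gi≡ → start i (trans (f≗g i) gi≡))
    , (λ start i fi≡ → start i (trans (sym (f≗g i)) fi≡)) ) (allFin n))

  runsT-cong : ∀ {n} {p q : ParentFn n} → p ≗ q → runsT p ≡ runsT q
  runsT-cong {n} {p} {q} p≗q = cong length (filter-≐ (runStartT? p) (runStartT? q)
    ( (λ start u qu≡ → start u (trans (p≗q u) qu≡))
    , (λ start u pu≡ → start u (trans (sym (p≗q u)) pu≡)) ) (allFin n))

  climb-cong : ∀ {n} {p q : ParentFn n} → p ≗ q → ∀ k x → climb p k x ≡ climb q k x
  climb-cong p≗q zero x = refl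
  climb-cong p≗q (suc k) nothing = refl
  climb-cong {p = p} {q} p≗q (suc k) (just x) = trans (cong (climb p k) (p≗q x)) (climb-cong p≗q k (q x))

  isCayleyTree-cong : ∀ {n} {p q : ParentFn n} → p ≗ q → IsCayleyTree p → IsCayleyTree q
  isCayleyTree-cong {n} {p} {q} p≗q (acyclic , one-root) =
    (λ v → trans (sym (climb-cong p≗q n (just v))) (acyclic v)) ,
    trans (cong length (filter-≐ (isRoot? q) (isRoot? p)
            ((λ {x} qx≡ → trans (p≗q x) qx≡) , (λ {x} px≡ → trans (sym (p≗q x)) px≡)) (allFin n)))
          one-root

module Search where

  open import Data.Nat using (zero; suc; z≤n; s≤s)
  open import Data.Fin using (Fin; zero; suc; _≤_)
  open import Data.Maybe using (Maybe; just; nothing)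
  open import Relation.Nullary using (yes; no; ¬_; contradiction)
  open import Relation.Unary using (Pred; Decidable)
  open import Level using (0ℓ)

  data Greatest {n : ℕ} (P : Pred (Fin n) 0ℓ) : Maybe (Fin n) → Set where
    found : ∀ i → P i → (∀ j → P j → j ≤ i) → Greatest P (just i)
    none  : (∀ j → ¬ P j) → Greatest P nothing

  data Least {n : ℕ} (P : Pred (Fin n) 0ℓ) : Maybe (Fin n) → Set where
    found : ∀ i → P i → (∀ j → P j → i ≤ j) → Least P (just i)
    none  : (∀ j → ¬ P j) → Least P nothing

  greatest : {n : ℕ} {P : Pred (Fin n) 0ℓ} → Decidable P → Maybe (Fin n)
  greatest {zero} _ = nothing
  greatest {suc n} P? with greatest (λ i → P? (suc i)) | P? zero
  ... | just i  | _     = just (suc i)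
  ... | nothing | yes _ = just zero
  ... | nothing | no _  = nothing

  greatest-spec : {n : ℕ} {P : Pred (Fin n) 0ℓ} (P? : Decidable P) → Greatest P (greatest P?)
  greatest-spec {zero} P? = none (λ ())
  greatest-spec {suc n} P?
    with greatest (λ i → P? (suc i)) | greatest-spec (λ i → P? (suc i)) | P? zero
  ... | just i  | found .i Pi max | _ =
    found (suc i) Pi λ { zero _ → z≤n ; (suc j) Pj → s≤s (max j Pj) }
  ... | nothing | none ¬P | yes P0 =
    found zero P0 λ { zero _ → z≤n ; (suc j) Pj → contradiction Pj (¬P j) }
  ... | nothing | none ¬P | no ¬P0 = none λ { zero → ¬P0 ; (suc j) → ¬P j }

  least : {n : ℕ} {P : Pred (Fin n) 0ℓ} → Decidable P → Maybe (Fin n)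
  least {zero} _ = nothing
  least {suc n} P? with P? zero | least (λ i → P? (suc i))
  ... | yes _ | _       = just zero
  ... | no _  | just i  = just (suc i)
  ... | no _  | nothing = nothing

  least-spec : {n : ℕ} {P : Pred (Fin n) 0ℓ} (P? : Decidable P) → Least P (least P?)
  least-spec {zero} P? = none (λ ())
  least-spec {suc n} P?
    with P? zero | least (λ i → P? (suc i)) | least-spec (λ i → P? (suc i))
  ... | yes P0 | _ | _ = found zero P0 (λ _ _ → z≤n)
  ... | no ¬P0 | just i | found .i Pi min =
    found (suc i) Pi λ { zero P0 → contradiction P0 ¬P0 ; (suc j) Pj → s≤s (min j Pj) }
  ... | no ¬P0 | nothing | none ¬P = none λ { zero → ¬P0 ; (suc j) → ¬P j }

module Orbits {n : ℕ} (f : Fin n → Fin n) where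

  open import Data.Nat using (zero; suc; _+_; _*_; _≤_; _<_; z≤n; s≤s; NonZero)
  open import Data.Nat.Properties
    using (+-comm; +-suc; *-comm; *-suc; n<1+n; m≤n⇒∃[o]m+o≡n; ≤-trans; <⇒≤; m≤n+m; <⇒≱; <-trans)
  open import Data.Nat.DivMod using (_%_; _/_; m≡m%n+[m/n]*n; m%n<n)
  open import Data.Fin using (Fin; toℕ; fromℕ<) renaming (_≤_ to _≤ᶠ_)
  open import Data.Fin.Properties
    using (pigeonhole; toℕ≤pred[n]; toℕ<n; toℕ-fromℕ<; any?; ≤-totalOrder; ≤-antisym; ≤-refl)
    renaming (_≟_ to _≟ᶠ_; ≤-trans to ≤ᶠ-trans)
  open import Algebra.Construct.NaturalChoice.Min (≤-totalOrder n) using (_⊓_; x⊓y≤x; x⊓y≤y; ⊓-sel)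
  open import Data.Product using (Σ; ∃; ∃₂; _×_; _,_; proj₂)
  open import Data.Sum using (inj₁; inj₂)
  open import Data.Maybe using (just; nothing; fromMaybe)
  open import Data.Empty using (⊥-elim)
  open import Relation.Nullary using (Dec; ¬_)
  open import Relation.Nullary.Decidable using (map′; _×-dec_)
  open import Relation.Binary.PropositionalEquality
    using (refl; sym; trans; cong; subst; module ≡-Reasoning)
  open Search

  iter : ℕ → Fin n → Fin n
  iter zero x = x
  iter (suc k) x = iter k (f x)

  iter-+ : ∀ a b x → iter (a + b) x ≡ iter b (iter a x)
  iter-+ zero b x = refl
  iter-+ (suc a) b x = iter-+ a b (f x)

  iter-suc : ∀ k x → iter (suc k) x ≡ f (iter k x)
  iter-suc zero x = refl
  iter-suc (suc k) x = iter-suc k (f x)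

  iter-comm : ∀ a b x → iter a (iter b x) ≡ iter b (iter a x)
  iter-comm a b x = trans (sym (iter-+ b a x)) (trans (cong (λ t → iter t x) (+-comm b a)) (iter-+ a b x))

  iter-periodic : ∀ {l x} → iter l x ≡ x → ∀ q → iter (q * l) x ≡ x
  iter-periodic e zero = refl
  iter-periodic {l} {x} e (suc q) = trans (iter-+ l (q * l) x) (trans (cong (iter (q * l)) e) (iter-periodic e q))

  -- Among x, f x, …, fⁿ x two points coincide: fⁱ x = fⁱ (f¹⁺ᵈ x) with i + 1 + d ≤ n.
  -- (opaque: only the statement is used, and unfolding the pigeonhole
  -- search makes case analyses on cyclicity needlessly expensive)
  opaque
    repetition : ∀ x → ∃₂ λ i d → i + suc d ≤ n × iter i x ≡ iter i (iter (suc d) x)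
    repetition x with pigeonhole (n<1+n n) (λ (i : Fin (suc n)) → iter (toℕ i) x)
    ... | i , j , i<j , e with m≤n⇒∃[o]m+o≡n i<j
    ... | d , i+1+d≡j = toℕ i , d , subst (_≤ n) (sym (trans (+-suc (toℕ i) d) i+1+d≡j)) (toℕ≤pred[n] j) ,
          trans e (trans (cong (λ t → iter t x) j≡) (iter-+ (suc d) (toℕ i) x))
      where
      j≡ : toℕ j ≡ suc d + toℕ i
      j≡ = trans (sym i+1+d≡j) (cong suc (+-comm (toℕ i) d))

  Cyclic : Fin n → Set
  Cyclic x = Σ ℕ λ k → iter (suc k) x ≡ x

  cyclic-orbit : ∀ {x} → Cyclic x → ∀ a → Cyclic (iter a x)
  cyclic-orbit {x} (k , e) a = k , trans (iter-comm (suc k) a x) (cong (iter a) e)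

  cyclic-f : ∀ {x} → Cyclic x → Cyclic (f x)
  cyclic-f c = cyclic-orbit c 1

  eventually-cyclic : ∀ x → ∃ λ a → Cyclic (iter a x)
  eventually-cyclic x with repetition x
  ... | i , d , _ , e = i , d , trans (iter-comm (suc d) i x) (sym e)

  cyclic-injective : ∀ {x y} → Cyclic x → Cyclic y → f x ≡ f y → x ≡ y
  cyclic-injective {x} {y} (k , x-period) (l , y-period) fx≡fy = begin
      x                       ≡⟨ sym (iter-periodic {suc k} x-period (suc l)) ⟩
      iter (suc l * suc k) x  ≡⟨ cong (iter (k + l * suc k)) fx≡fy ⟩
      iter (suc l * suc k) y  ≡⟨ cong (λ t → iter t y) (*-comm (suc l) (suc k)) ⟩
      iter (suc k * suc l) y  ≡⟨ iter-periodic {suc l} y-period (suc k) ⟩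
      y                       ∎
    where open ≡-Reasoning

  iter-injective : ∀ {x y} → Cyclic x → Cyclic y → ∀ a → iter a x ≡ iter a y → x ≡ y
  iter-injective cx cy zero e = e
  iter-injective cx cy (suc a) e =
    cyclic-injective cx cy (iter-injective (cyclic-f cx) (cyclic-f cy) a e)

  -- a cyclic point has period at most n, which makes cyclicity decidable
  short-period : ∀ {x} → Cyclic x → Σ (Fin n) λ k → iter (suc (toℕ k)) x ≡ x
  short-period {x} cx with repetition x
  ... | i , d , bound , e = fromℕ< d<n ,
        subst (λ t → iter (suc t) x ≡ x) (sym (toℕ-fromℕ< d<n))
          (sym (iter-injective cx (cyclic-orbit cx (suc d)) i e))
    where
    d<n : d < n
    d<n = ≤-trans (m≤n+m (suc d) i) bound

  -- (opaque for the same reason as repetition)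
  opaque
    cyclic? : ∀ x → Dec (Cyclic x)
    cyclic? x = map′ (λ (k , e) → toℕ k , e) short-period (any? (λ k → iter (suc (toℕ k)) x ≟ᶠ x))

  orbit-returns : ∀ {x} → Cyclic x → ∀ a → ∃ λ b → iter b (iter a x) ≡ x
  orbit-returns {x} (k , e) a = a * k , trans (sym (iter-+ a (a * k) x))
    (trans (cong (λ t → iter t x) (sym (*-suc a k))) (iter-periodic e a))

  iter-mod : ∀ {x} L .{{_ : NonZero L}} → iter L x ≡ x → ∀ j → iter j x ≡ iter (j % L) x
  iter-mod {x} L period j = begin
      iter j x                           ≡⟨ cong (λ t → iter t x) (m≡m%n+[m/n]*n j L) ⟩
      iter (j % L + j / L * L) x         ≡⟨ cong (λ t → iter t x) (+-comm (j % L) (j / L * L)) ⟩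
      iter (j / L * L + j % L) x         ≡⟨ iter-+ (j / L * L) (j % L) x ⟩
      iter (j % L) (iter (j / L * L) x)  ≡⟨ cong (iter (j % L)) (iter-periodic period (j / L)) ⟩
      iter (j % L) x                     ∎
    where open ≡-Reasoning

  orbitMin : ℕ → Fin n → Fin n
  orbitMin zero x = x
  orbitMin (suc k) x = x ⊓ orbitMin k (f x)

  orbitMin-≤ : ∀ k j x → j ≤ k → orbitMin k x ≤ᶠ iter j x
  orbitMin-≤ zero zero x _ = ≤-refl
  orbitMin-≤ (suc k) zero x _ = x⊓y≤x x (orbitMin k (f x))
  orbitMin-≤ (suc k) (suc j) x (s≤s j≤k) =
    ≤ᶠ-trans (x⊓y≤y x (orbitMin k (f x))) (orbitMin-≤ k j (f x) j≤k)

  orbitMin-attained : ∀ k x → ∃ λ j → orbitMin k x ≡ iter j x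
  orbitMin-attained zero x = 0 , refl
  orbitMin-attained (suc k) x with ⊓-sel x (orbitMin k (f x))
  ... | inj₁ e = 0 , e
  ... | inj₂ e = let (j , e′) = orbitMin-attained k (f x) in suc j , trans e e′

  -- for cyclic x: the least element of the cycle through x
  cycleMin : Fin n → Fin n
  cycleMin x = orbitMin n x

  cycleMin-≤self : ∀ x → cycleMin x ≤ᶠ x
  cycleMin-≤self x = orbitMin-≤ n 0 x z≤n

  cycleMin-attained : ∀ x → ∃ λ j → cycleMin x ≡ iter j x
  cycleMin-attained x = orbitMin-attained n x

  cycleMin-≤ : ∀ {x} → Cyclic x → ∀ j → cycleMin x ≤ᶠ iter j x
  cycleMin-≤ {x} c j with short-period c
  ... | k , period = subst (cycleMin x ≤ᶠ_) (sym (iter-mod (suc (toℕ k)) period j))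
        (orbitMin-≤ n (j % suc (toℕ k)) x (≤-trans (<⇒≤ (m%n<n j (suc (toℕ k)))) (toℕ<n k)))

  cycleMin-in-period : ∀ {y t} → iter (suc t) y ≡ y → ∃ λ s → s < suc t × cycleMin y ≡ iter (suc s) y
  cycleMin-in-period {y} {t} period with cycleMin-attained y
  ... | j , e with j % suc t | m%n<n j (suc t) | iter-mod (suc t) period j
  ...   | zero  | _    | e′ = t , n<1+n t , trans e (trans e′ (sym period))
  ...   | suc s | s<t | e′ = s , <⇒≤ s<t , trans e e′

  cycleMin-unique : ∀ {x z a} → Cyclic x → z ≡ iter a x → (∀ j → z ≤ᶠ iter j x) → z ≡ cycleMin x
  cycleMin-unique {x} {z} {a} c z-on-orbit z-least with cycleMin-attained x
  ... | j , e = ≤-antisym (subst (z ≤ᶠ_) (sym e) (z-least j))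
                          (subst (cycleMin x ≤ᶠ_) (sym z-on-orbit) (cycleMin-≤ c a))

  cycleMin-orbit : ∀ {x} → Cyclic x → ∀ a → cycleMin (iter a x) ≡ cycleMin x
  cycleMin-orbit {x} c a with orbit-returns c a | cycleMin-attained x
  ... | b , eb | j , ej = sym (cycleMin-unique {a = b + j} (cyclic-orbit c a)
        (trans ej (trans (cong (iter j) (sym eb)) (sym (iter-+ b j (iter a x)))))
        (λ k → subst (cycleMin x ≤ᶠ_) (iter-+ a k x) (cycleMin-≤ c (a + k))))

  cycleMin-f : ∀ {x} → Cyclic x → cycleMin (f x) ≡ cycleMin x
  cycleMin-f c = cycleMin-orbit c 1

  IsCycleMin : Fin n → Set
  IsCycleMin c = Cyclic c × cycleMin c ≡ c

  isCycleMin? : ∀ c → Dec (IsCycleMin c)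
  isCycleMin? c = cyclic? c ×-dec (cycleMin c ≟ᶠ c)

  cycleMin-isCycleMin : ∀ {x} → Cyclic x → IsCycleMin (cycleMin x)
  cycleMin-isCycleMin {x} c with cycleMin-attained x
  ... | j , e = subst Cyclic (sym e) (cyclic-orbit c j) , trans (cong cycleMin e) (cycleMin-orbit c j)

  isCycleMin-orbit : ∀ {x} → Cyclic x → ∀ a → IsCycleMin (iter a x) → iter a x ≡ cycleMin x
  isCycleMin-orbit c a (_ , e) = trans (sym e) (cycleMin-orbit c a)

  isCycleMin-f : ∀ {x} → Cyclic x → IsCycleMin (f x) → f x ≡ cycleMin x
  isCycleMin-f c = isCycleMin-orbit c 1

  fixed-isCycleMin : ∀ {u} → f u ≡ u → IsCycleMin u
  fixed-isCycleMin {u} fu≡u = (0 , fu≡u) , sym (cycleMin-unique {a = 0} (0 , fu≡u) refl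
    (λ j → subst (u ≤ᶠ_) (sym (iter-fixed j)) ≤-refl))
    where
    iter-fixed : ∀ j → iter j u ≡ u
    iter-fixed zero = refl
    iter-fixed (suc j) = trans (cong (iter j) fu≡u) (iter-fixed j)

  first-return : ∀ {c} → IsCycleMin c →
    ∃ λ m → iter (suc m) c ≡ c × (∀ s → s < m → ¬ IsCycleMin (iter (suc s) c))
  first-return {c} c-min@(cc , _)
    with least (λ (s : Fin n) → isCycleMin? (iter (suc (toℕ s)) c))
       | least-spec (λ (s : Fin n) → isCycleMin? (iter (suc (toℕ s)) c))
  ... | just m | found .m returned first =
        toℕ m , trans (isCycleMin-orbit cc (suc (toℕ m)) returned) (proj₂ c-min) , earlier
    where
    earlier : ∀ s → s < toℕ m → ¬ IsCycleMin (iter (suc s) c)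
    earlier s s<m returned-s = <⇒≱ s<m (subst (toℕ m ≤_) (toℕ-fromℕ< s<n)
      (first (fromℕ< s<n) (subst (λ t → IsCycleMin (iter (suc t) c)) (sym (toℕ-fromℕ< s<n)) returned-s)))
      where
      s<n : s < n
      s<n = <-trans s<m (toℕ<n m)
  ... | nothing | none never with short-period cc
  ...   | k , period = ⊥-elim (never k (subst IsCycleMin (sym period) c-min))

  cycle-predecessor : ∀ {c} → Cyclic c → ∃ λ r → Cyclic r × f r ≡ c
  cycle-predecessor {c} cc@(k , period) = iter k c , cyclic-orbit cc k , trans (sym (iter-suc k c)) period

  module _ (x₀ : Fin n) where

    some-cycleMin : ∃ IsCycleMin
    some-cycleMin = _ , cycleMin-isCycleMin (proj₂ (eventually-cyclic x₀))

    lastCycleMin : Fin n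
    lastCycleMin = fromMaybe x₀ (greatest isCycleMin?)

    lastCycleMin-spec : IsCycleMin lastCycleMin × (∀ c → IsCycleMin c → c ≤ᶠ lastCycleMin)
    lastCycleMin-spec with greatest isCycleMin? | greatest-spec isCycleMin?
    ... | just c  | found .c min greatest = min , greatest
    ... | nothing | none ¬min = ⊥-elim (¬min _ (proj₂ some-cycleMin))

    firstCycleMin : Σ (Fin n) λ c → IsCycleMin c × (∀ c′ → IsCycleMin c′ → c ≤ᶠ c′)
    firstCycleMin with least isCycleMin? | least-spec isCycleMin?
    ... | just c  | found .c min least = c , min , least
    ... | nothing | none ¬min = ⊥-elim (¬min _ (proj₂ some-cycleMin))

module Climbing {n : ℕ} (p : ParentFn n) where

  open import Data.Nat using (zero; suc; _+_; _*_; _≤_; _<_; _<?_; _∸_)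
  open import Data.Nat.Properties using (*-suc; n<1+n; m≤n⇒∃[o]m+o≡n; +-suc; m+[n∸m]≡n; ≮⇒≥)
  open import Data.Fin using (toℕ; fromℕ<)
  open import Data.Fin.Properties using (pigeonhole; any?; toℕ-fromℕ<; toℕ≤pred[n]) renaming (_≟_ to _≟ᶠ_)
  open import Data.Maybe using (Maybe; just; nothing; fromMaybe)
  import Data.Maybe.Properties as Maybe
  open import Data.Product using (Σ; ∃; _,_)
  open import Data.Empty using (⊥-elim)
  open import Relation.Nullary using (Dec; yes; no)
  open import Relation.Binary.PropositionalEquality
    using (_≢_; refl; sym; trans; cong; subst; module ≡-Reasoning)

  climb-nothing : ∀ k → climb p k nothing ≡ nothing
  climb-nothing zero = refl
  climb-nothing (suc k) = refl

  climb-+ : ∀ a b m → climb p (a + b) m ≡ climb p b (climb p a m)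
  climb-+ zero b m = refl
  climb-+ (suc a) b nothing = sym (climb-nothing b)
  climb-+ (suc a) b (just x) = climb-+ a b (p x)

  climb-prefix : ∀ a b m {z} → climb p (a + b) m ≡ just z → ∃ λ w → climb p a m ≡ just w
  climb-prefix a b m e with climb p a m | climb-+ a b m
  ... | just w  | _ = w , refl
  ... | nothing | e′ with () ← trans (sym e) (trans e′ (climb-nothing b))

  NoCycle : Set
  NoCycle = ∀ y t → climb p (suc t) (just y) ≢ just y

  -- the node reached from v after i steps (v itself if the climb left the tree)
  pathNode : Fin n → Fin (suc n) → Fin n
  pathNode v i = fromMaybe v (climb p (toℕ i) (just v))

  path-defined : ∀ {v z} → climb p n (just v) ≡ just z →
    ∀ i → climb p (toℕ i) (just v) ≡ just (pathNode v i)
  path-defined {v} climb-n i with climb-prefix (toℕ i) (n ∸ toℕ i) (just v)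
    (trans (cong (λ t → climb p t (just v)) (m+[n∸m]≡n (toℕ≤pred[n] i))) climb-n)
  ... | w , e = trans e (cong (λ m → just (fromMaybe v m)) (sym e))

  -- A climb of n steps from v visits n + 1 positions; by pigeonhole two of
  -- them carry the same node, which closes a cycle.
  noCycle⇒acyclic : NoCycle → Acyclic p
  noCycle⇒acyclic noCycle v with climb p n (just v) in climb-n
  ... | nothing = refl
  ... | just _ with pigeonhole (n<1+n n) (pathNode v)
  ...   | i , j , i<j , same with m≤n⇒∃[o]m+o≡n i<j
  ...     | d , i+1+d≡j = ⊥-elim (noCycle (pathNode v i) d (begin
      climb p (suc d) (just (pathNode v i))       ≡⟨ cong (climb p (suc d)) (sym (on-path i)) ⟩
      climb p (suc d) (climb p (toℕ i) (just v))  ≡⟨ sym (climb-+ (toℕ i) (suc d) (just v)) ⟩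
      climb p (toℕ i + suc d) (just v)            ≡⟨ cong (λ t → climb p t (just v))
                                                              (trans (+-suc (toℕ i) d) i+1+d≡j) ⟩
      climb p (toℕ j) (just v)                    ≡⟨ on-path j ⟩
      just (pathNode v j)                         ≡⟨ cong just (sym same) ⟩
      just (pathNode v i)                         ∎))
    where
    open ≡-Reasoning
    on-path : ∀ i → climb p (toℕ i) (just v) ≡ just (pathNode v i)
    on-path = path-defined climb-n

  Reach : Fin n → Fin n → Set
  Reach a b = Σ ℕ λ k → climb p k (just a) ≡ just b

  reach-refl : ∀ a → Reach a a
  reach-refl a = 0 , refl

  reach-trans : ∀ {a b c} → Reach a b → Reach b c → Reach a c
  reach-trans {a} (k , e) (l , e′) = k + l , trans (climb-+ k l (just a)) (trans (cong (climb p l) e) e′)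

  reach-step : ∀ {a b} → p a ≡ just b → Reach a b
  reach-step e = 1 , e

  climb-further : ∀ {i j a b c} → i ≤ j →
    climb p i (just a) ≡ just b → climb p j (just a) ≡ just c → Reach b c
  climb-further {i} {j} {a} {b} {c} i≤j a→b a→c = j ∸ i , (begin
    climb p (j ∸ i) (just b)                  ≡⟨ cong (climb p (j ∸ i)) (sym a→b) ⟩
    climb p (j ∸ i) (climb p i (just a))      ≡⟨ sym (climb-+ i (j ∸ i) (just a)) ⟩
    climb p (i + (j ∸ i)) (just a)            ≡⟨ cong (λ t → climb p t (just a)) (m+[n∸m]≡n i≤j) ⟩
    climb p j (just a)                        ≡⟨ a→c ⟩
    just c                                    ∎)
    where open ≡-Reasoning

  -- ancestry within fewer than n steps; it is decidable
  ReachB : Fin n → Fin n → Set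
  ReachB a b = Σ (Fin n) λ k → climb p (toℕ k) (just a) ≡ just b

  reachB? : ∀ a b → Dec (ReachB a b)
  reachB? a b = any? (λ k → Maybe.≡-dec _≟ᶠ_ (climb p (toℕ k) (just a)) (just b))

  reachB⇒reach : ∀ {a b} → ReachB a b → Reach a b
  reachB⇒reach (k , e) = toℕ k , e

  climb-periodic : ∀ {y t} → climb p t (just y) ≡ just y → ∀ q → climb p (q * t) (just y) ≡ just y
  climb-periodic e zero = refl
  climb-periodic {y} {t} e (suc q) =
    trans (climb-+ t (q * t) (just y)) (trans (cong (climb p (q * t)) e) (climb-periodic e q))

  module _ (acyclic : Acyclic p) where

    climb-beyond : ∀ k a → climb p (n + k) (just a) ≡ nothing
    climb-beyond k a = trans (climb-+ n k (just a)) (trans (cong (climb p k) (acyclic a)) (climb-nothing k))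

    climb-bound : ∀ k a {b} → climb p k (just a) ≡ just b → k < n
    climb-bound k a e with k <? n
    ... | yes k<n = k<n
    ... | no k≮n with () ← trans (sym e)
          (trans (cong (λ t → climb p t (just a)) (sym (m+[n∸m]≡n (≮⇒≥ k≮n)))) (climb-beyond (k ∸ n) a))

    reach⇒reachB : ∀ {a b} → Reach a b → ReachB a b
    reach⇒reachB {a} (k , e) = fromℕ< k<n ,
      subst (λ t → climb p t (just a) ≡ just _) (sym (toℕ-fromℕ< k<n)) e
      where
      k<n : k < n
      k<n = climb-bound k a e

    acyclic⇒noCycle : NoCycle
    acyclic⇒noCycle y t e with () ← trans (sym (climb-beyond (n * t) y))
      (trans (cong (λ s → climb p s (just y)) (sym (*-suc n t))) (climb-periodic e n))

module TreeFacts {n : ℕ} (p : ParentFn n) (tree : IsCayleyTree p) where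

  open import Data.Nat using (zero; suc; _+_)
  open import Data.Nat.Properties using (≤-total)
  open import Data.Maybe using (just; nothing)
  open import Data.Maybe.Properties using (just-injective)
  open import Data.Product using (Σ; _×_; _,_; proj₁; proj₂)
  open import Data.Sum using (_⊎_; inj₁; inj₂)
  open import Data.Empty using (⊥-elim)
  open import Relation.Binary.PropositionalEquality using (_≢_; sym; trans; cong; subst)
  open Counting using (count-one⁻)

  open Climbing p

  private
    root-data : Σ (Fin n) λ r → IsRoot p r × (∀ y → IsRoot p y → y ≡ r)
    root-data = count-one⁻ (isRoot? p) (proj₂ tree)

  root : Fin n
  root = proj₁ root-data

  root-parent : p root ≡ nothing
  root-parent = proj₁ (proj₂ root-data)

  root-unique : ∀ y → p y ≡ nothing → y ≡ root
  root-unique = proj₂ (proj₂ root-data)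

  climb-to-root : ∀ t x → climb p t (just x) ≡ nothing → Reach x root
  climb-to-root (suc t) x e with p x in px
  ... | nothing = subst (Reach x) (root-unique x px) (reach-refl x)
  ... | just y = reach-trans (reach-step px) (climb-to-root t y e)

  reach-root : ∀ x → Reach x root
  reach-root x = climb-to-root n x (proj₁ tree x)

  ancestors-chain : ∀ {a b c} → Reach a b → Reach a c → Reach b c ⊎ Reach c b
  ancestors-chain (i , a→b) (j , a→c) with ≤-total i j
  ... | inj₁ i≤j = inj₁ (climb-further i≤j a→b a→c)
  ... | inj₂ j≤i = inj₂ (climb-further j≤i a→c a→b)

  no-cycle : NoCycle
  no-cycle = acyclic⇒noCycle (proj₁ tree)

  reach-antisym : ∀ {a b} → Reach a b → Reach b a → a ≡ b
  reach-antisym (zero , a→b) _ = just-injective a→b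
  reach-antisym {a} (suc i , a→b) (j , b→a) =
    ⊥-elim (no-cycle a (i + j) (trans (climb-+ (suc i) j (just a)) (trans (cong (climb p j) a→b) b→a)))

  reach-via-parent : ∀ {x y z} → p x ≡ just y → Reach x z → x ≢ z → Reach y z
  reach-via-parent _ (zero , x→z) x≢z = ⊥-elim (x≢z (just-injective x→z))
  reach-via-parent px (suc k , x→z) _ = k , trans (cong (climb p k) (sym px)) x→z

  root-maximal : ∀ {z} → Reach root z → z ≡ root
  root-maximal (zero , e) = sym (just-injective e)
  root-maximal (suc k , e) with () ← trans (sym e) (trans (cong (climb p k) root-parent) (climb-nothing k))

  no-self-loop : ∀ {x} → p x ≢ just x
  no-self-loop {x} = no-cycle x 0

-- Each cycle of f is cut just before
-- its minimum c: the edge x → c is redirected to the previous cycle minimum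
-- (the greatest one below c), and for the least cycle minimum x becomes the
-- root.
module Cutting {n : ℕ} (f : Fin n → Fin n) where

  open import Data.Nat using (zero; suc; _<?_; s≤s)
  import Data.Nat as ℕ
  open import Data.Nat.Properties
    using (<-irrefl; <-trans; <⇒≤; ≮⇒≥; ≤⇒≯; <⇒≱; m≤n⇒m<n∨m≡n; <-≤-trans)
  open import Data.Fin using (toℕ; _≤_; _<_)
  open import Data.Fin.Properties using (toℕ-injective; ≤-antisym)
  open import Data.Maybe using (Maybe; just; nothing)
  open import Data.Maybe.Properties using (just-injective)
  open import Data.List using (allFin; length)
  open import Data.List.Properties using (filter-≐)
  open import Data.Product using (Σ; _×_; _,_; proj₁; proj₂)
  open import Data.Sum using (_⊎_; inj₁; inj₂)
  open import Data.Empty using (⊥-elim)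
  open import Relation.Nullary using (yes; no; ¬_)
  open import Relation.Nullary.Decidable using (_×-dec_)
  open import Relation.Binary.PropositionalEquality using (_≢_; refl; sym; trans; cong; subst)
  open Search
  open Counting using (count-one)

  open Orbits f public

  prevMin : Fin n → Maybe (Fin n)
  prevMin c = greatest (λ y → isCycleMin? y ×-dec (toℕ y <? toℕ c))

  prevMin-spec : ∀ c → Greatest (λ y → IsCycleMin y × y < c) (prevMin c)
  prevMin-spec c = greatest-spec (λ y → isCycleMin? y ×-dec (toℕ y <? toℕ c))

  prevMin-just : ∀ {c y} → prevMin c ≡ just y → IsCycleMin y × y < c
  prevMin-just {c} e with prevMin c | prevMin-spec c
  prevMin-just refl | just y | found .y below _ = below

  prevMin-nothing : ∀ {c} → prevMin c ≡ nothing → ∀ y → IsCycleMin y → ¬ (y < c)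
  prevMin-nothing {c} e with prevMin c | prevMin-spec c
  prevMin-nothing refl | nothing | none ¬below = λ y min y<c → ¬below y (min , y<c)

  prevMin-of-least : ∀ {c} → (∀ y → IsCycleMin y → c ≤ y) → prevMin c ≡ nothing
  prevMin-of-least {c} least with prevMin c | prevMin-spec c
  ... | nothing | _ = refl
  ... | just y | found .y (y-min , y<c) _ with () ← ≤⇒≯ (least y y-min) y<c

  prevMin-of-next : ∀ {c c′} → IsCycleMin c → c < c′ → (∀ y → IsCycleMin y × c < y → c′ ≤ y) →
    prevMin c′ ≡ just c
  prevMin-of-next {c} {c′} c-min c<c′ next
    with prevMin c′ | prevMin-spec c′
  ... | nothing | none ¬below = ⊥-elim (¬below c (c-min , c<c′))
  ... | just i | found .i (i-min , i<c′) greatest with m≤n⇒m<n∨m≡n (greatest c (c-min , c<c′))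
  ...   | inj₁ c<i = ⊥-elim (<⇒≱ i<c′ (next i (i-min , c<i)))
  ...   | inj₂ c≡i = cong just (toℕ-injective (sym c≡i))

  cut : ParentFn n
  cut x with cyclic? x ×-dec isCycleMin? (f x)
  ... | yes _ = prevMin (f x)
  ... | no _  = just (f x)

  cut-closing : ∀ {x} → Cyclic x → IsCycleMin (f x) → cut x ≡ prevMin (f x)
  cut-closing {x} cx min with cyclic? x ×-dec isCycleMin? (f x)
  ... | yes _ = refl
  ... | no ¬closing = ⊥-elim (¬closing (cx , min))

  cut-other : ∀ {x} → ¬ (Cyclic x × IsCycleMin (f x)) → cut x ≡ just (f x)
  cut-other {x} ¬closing with cyclic? x ×-dec isCycleMin? (f x)
  ... | yes closing = ⊥-elim (¬closing closing)
  ... | no _ = refl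

  runStart-below : ∀ {j u} → RunStartM f j → f u ≡ j → f u ≢ u → toℕ j ℕ.< toℕ u
  runStart-below {j} {u} start fu≡j fu≢u with m≤n⇒m<n∨m≡n (start u fu≡j)
  ... | inj₁ j<u = j<u
  ... | inj₂ j≡u = ⊥-elim (fu≢u (trans fu≡j (toℕ-injective j≡u)))

  -- The properties of the cut tree are proved for every parent function p
  -- agreeing pointwise with cut (the counting argument needs p = lookup (tabulate cut)).
  module CutTree (p : ParentFn n) (p≗cut : ∀ x → p x ≡ cut x) where

    open Climbing p

    parent-of-noncyclic : ∀ {x} → ¬ Cyclic x → p x ≡ just (f x)
    parent-of-noncyclic ¬cx = trans (p≗cut _) (cut-other (λ closing → ¬cx (proj₁ closing)))

    parent-of-cyclic : ∀ {x y} → Cyclic x → p x ≡ just y →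
      (IsCycleMin y × y < cycleMin x) ⊎ (y ≡ f x × ¬ IsCycleMin (f x))
    parent-of-cyclic {x} cx e with isCycleMin? (f x)
    ... | no ¬min =
      inj₂ (just-injective (trans (sym e) (trans (p≗cut x) (cut-other (λ closing → ¬min (proj₂ closing))))) ,
            ¬min)
    ... | yes min with prevMin-just (trans (sym (cut-closing cx min)) (trans (sym (p≗cut x)) e))
    ...   | y-min , y<fx = inj₁ (y-min , subst (_ <_) (isCycleMin-f cx min) y<fx)

    parent-cyclic : ∀ {x y} → Cyclic x → p x ≡ just y → Cyclic y
    parent-cyclic cx e with parent-of-cyclic cx e
    ... | inj₁ (min , _) = proj₁ min
    ... | inj₂ (refl , _) = cyclic-f cx

    climb-cyclic : ∀ t {x z} → Cyclic x → climb p t (just x) ≡ just z → Cyclic z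
    climb-cyclic zero cx refl = cx
    climb-cyclic (suc t) {x} cx e with p x in px
    ... | nothing with () ← trans (sym e) (climb-nothing t)
    ... | just y = climb-cyclic t (parent-cyclic cx px) e

    climb-noncyclic : ∀ t {x z} → climb p t (just x) ≡ just z → Cyclic z ⊎ z ≡ iter t x
    climb-noncyclic zero refl = inj₂ refl
    climb-noncyclic (suc t) {x} e with cyclic? x
    ... | yes cx = inj₁ (climb-cyclic (suc t) cx e)
    ... | no ¬cx = climb-noncyclic t (trans (cong (climb p t) (sym (parent-of-noncyclic ¬cx))) e)

    climb-from-cyclic : ∀ t {x z} → Cyclic x → climb p t (just x) ≡ just z →
      (cycleMin z < cycleMin x) ⊎ (z ≡ iter t x × (∀ s → s ℕ.< t → ¬ IsCycleMin (iter (suc s) x)))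
    climb-from-cyclic zero cx refl = inj₂ (refl , λ _ ())
    climb-from-cyclic (suc t) {x} {z} cx e with p x in px
    ... | nothing with () ← trans (sym e) (climb-nothing t)
    ... | just y with parent-of-cyclic cx px | climb-from-cyclic t (parent-cyclic cx px) e
    ...   | inj₁ (min , y<x) | inj₁ z<y = inj₁ (<-trans z<y (subst (_< cycleMin x) (sym (proj₂ min)) y<x))
    ...   | inj₁ (min , y<x) | inj₂ (refl , _) =
            inj₁ (subst (_< cycleMin x) (sym (trans (cycleMin-orbit (proj₁ min) t) (proj₂ min))) y<x)
    ...   | inj₂ (refl , _) | inj₁ z<fx = inj₁ (subst (cycleMin z <_) (cycleMin-f cx) z<fx)
    ...   | inj₂ (refl , ¬min) | inj₂ (z≡ , unvisited) =
            inj₂ (z≡ , λ { zero _ → ¬min ; (suc s) (s≤s s<t) → unvisited s s<t })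

    -- a cycle of p would be a cycle of f containing no cycle minimum
    cut-noCycle : NoCycle
    cut-noCycle y t e with cyclic? y
    ... | no ¬cy with climb-noncyclic (suc t) e
    ...   | inj₁ cy = ¬cy cy
    ...   | inj₂ y≡ = ¬cy (t , sym y≡)
    cut-noCycle y t e | yes cy with climb-from-cyclic (suc t) cy e
    ... | inj₁ y<y = <-irrefl refl y<y
    ... | inj₂ (y≡ , unvisited) with cycleMin-in-period (sym y≡)
    ...   | s , s<t+1 , min≡ = unvisited s s<t+1 (subst IsCycleMin min≡ (cycleMin-isCycleMin cy))

    cut-acyclic : Acyclic p
    cut-acyclic = noCycle⇒acyclic cut-noCycle

    parentless : ∀ {x} → p x ≡ nothing → Cyclic x × IsCycleMin (f x) × prevMin (f x) ≡ nothing
    parentless {x} e with cyclic? x ×-dec isCycleMin? (f x)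
    ... | yes (cx , min) = cx , min , trans (sym (cut-closing cx min)) (trans (sym (p≗cut x)) e)
    ... | no ¬closing with () ← trans (sym e) (trans (p≗cut x) (cut-other ¬closing))

    -- the unique root closes the cycle of the least cycle minimum
    cut-root : Fin n → Σ (Fin n) λ r → p r ≡ nothing × (∀ x → p x ≡ nothing → x ≡ r)
    cut-root x₀ with firstCycleMin x₀
    ... | c₀ , c₀-min , least with cycle-predecessor (proj₁ c₀-min)
    ...   | r , cr , f-r = r , p-r , unique
      where
      p-r : p r ≡ nothing
      p-r = trans (p≗cut r) (trans (cut-closing cr (subst IsCycleMin (sym f-r) c₀-min))
                                   (trans (cong prevMin f-r) (prevMin-of-least least)))
      unique : ∀ x → p x ≡ nothing → x ≡ r
      unique x e with parentless e
      ... | cx , min , nothing-below = cyclic-injective cx cr (trans fx≡c₀ (sym f-r))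
        where
        fx≡c₀ : f x ≡ c₀
        fx≡c₀ = ≤-antisym (≮⇒≥ (prevMin-nothing nothing-below c₀ c₀-min)) (least (f x) min)

    cut-isTree : Fin n → IsCayleyTree p
    cut-isTree x₀ with cut-root x₀
    ... | r , p-r , unique = cut-acyclic , count-one (isRoot? p) r p-r unique

    -- run starts of f stay run starts: a child of j in the tree is either a
    -- preimage of j under f or the end of a cycle whose minimum is above j
    runStart⇒ : ∀ {j} → RunStartM f j → RunStartT p j
    runStart⇒ {j} start u e with cyclic? u
    ... | no ¬cu =
      runStart-below start (just-injective (trans (sym (parent-of-noncyclic ¬cu)) e)) (λ fu≡u → ¬cu (0 , fu≡u))
    ... | yes cu with parent-of-cyclic cu e
    ...   | inj₁ (_ , j<u) = <-≤-trans j<u (cycleMin-≤self u)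
    ...   | inj₂ (j≡fu , ¬min) =
      runStart-below start (sym j≡fu) (λ fu≡u → ¬min (subst IsCycleMin (sym fu≡u) (fixed-isCycleMin fu≡u)))

    -- conversely, the preimages of j that are not tree children of j are the
    -- ends of cycles with minimum j, which lie above j
    runStart⇐ : ∀ {j} → RunStartT p j → RunStartM f j
    runStart⇐ {j} start i fi≡j with cyclic? i ×-dec isCycleMin? (f i)
    ... | yes (ci , min) = subst (_≤ i) (trans (sym (isCycleMin-f ci min)) fi≡j) (cycleMin-≤self i)
    ... | no ¬closing = <⇒≤ (start i (trans (p≗cut i) (trans (cut-other ¬closing) (cong just fi≡j))))

    runs-cut : runsM f ≡ runsT p
    runs-cut = cong length (filter-≐ (runStartM? f) (runStartT? p) (runStart⇒ , runStart⇐) (allFin n))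

-- On the
-- path from v to the root, every left-to-right minimum starts a new segment;
-- each segment is closed into a cycle by sending its last node to the
-- segment's minimum.
module Gluing {n : ℕ} (p : ParentFn n) (v : Fin n) where

  open import Data.Fin.Properties using () renaming (_≟_ to _≟ᶠ_)
  open import Data.Maybe using (just; nothing; fromMaybe)
  open import Data.Product using (∃; _×_; _,_)
  open import Data.Sum using (_⊎_; inj₂)
  open import Data.Empty using (⊥-elim)
  open import Relation.Nullary using (Dec; yes; no; ¬_)
  open import Relation.Nullary.Decidable using (_×-dec_)
  open import Relation.Binary.PropositionalEquality using (refl)
  open Search

  open Climbing p public

  Between : Fin n → Fin n → Set
  Between x y = ReachB v y × ReachB y x

  between? : ∀ x y → Dec (Between x y)
  between? x y = reachB? v y ×-dec reachB? y x

  segMin : Fin n → Fin n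
  segMin x = fromMaybe x (least (between? x))

  segMin-spec : ∀ x → Least (Between x) (least (between? x))
  segMin-spec x = least-spec (between? x)

  LtrMin : Fin n → Set
  LtrMin y = ReachB v y × segMin y ≡ y

  ltrMin? : ∀ y → Dec (LtrMin y)
  ltrMin? y = reachB? v y ×-dec (segMin y ≟ᶠ y)

  glue : Fin n → Fin n
  glue x with reachB? v x | p x
  ... | yes _ | nothing = segMin x
  ... | yes _ | just y with ltrMin? y
  ...   | yes _ = segMin x
  ...   | no _  = y
  glue x | no _ | nothing = x
  glue x | no _ | just y  = y

  SegEnd : Fin n → Set
  SegEnd x = p x ≡ nothing ⊎ (∃ λ y → p x ≡ just y × LtrMin y)

  glue-closing : ∀ {x} → ReachB v x → SegEnd x → glue x ≡ segMin x
  glue-closing {x} on-path end with reachB? v x | p x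
  ... | no off | _ = ⊥-elim (off on-path)
  ... | yes _ | nothing = refl
  ... | yes _ | just y with ltrMin? y | end
  ...   | yes _ | _ = refl
  ...   | no ¬ltr | inj₂ (_ , refl , ltr) = ⊥-elim (¬ltr ltr)

  glue-other : ∀ {x y} → p x ≡ just y → ¬ (ReachB v x × LtrMin y) → glue x ≡ y
  glue-other {x} {y} px ¬closing with reachB? v x | p x
  glue-other refl ¬closing | yes on-path | just y with ltrMin? y
  ... | yes ltr = ⊥-elim (¬closing (on-path , ltr))
  ... | no _ = refl
  glue-other refl ¬closing | no _ | just _ = refl

module SegmentMinima {n : ℕ} (p : ParentFn n) (tree : IsCayleyTree p) (v : Fin n) where

  open import Data.Fin using (_≤_; _<_)
  open import Data.Fin.Properties using (≤-antisym; toℕ-injective) renaming (_≟_ to _≟ᶠ_)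
  open import Data.Nat.Properties using (m≤n⇒m<n∨m≡n)
  open import Data.Maybe using (just; nothing)
  open import Data.Product using (_×_; _,_; proj₁; proj₂)
  open import Data.Sum using (inj₁; inj₂)
  open import Data.Empty using (⊥-elim)
  open import Relation.Nullary using (yes; no; ¬_)
  open import Relation.Binary.PropositionalEquality using (sym; subst)
  open Search

  open Gluing p v public
  open TreeFacts p tree public

  toB : ∀ {a b} → Reach a b → ReachB a b
  toB = reach⇒reachB (proj₁ tree)

  OnPath : Fin n → Set
  OnPath x = Reach v x

  segMin-between : ∀ {x} → OnPath x → OnPath (segMin x) × Reach (segMin x) x
  segMin-between {x} on-x with least (between? x) | segMin-spec x
  ... | nothing | none ¬between = ⊥-elim (¬between v (toB (reach-refl v) , toB on-x))
  ... | just i | found .i (v→i , i→x) _ = reachB⇒reach v→i , reachB⇒reach i→x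

  segMin-least : ∀ {x} → OnPath x → ∀ y → OnPath y → Reach y x → segMin x ≤ y
  segMin-least {x} on-x y on-y y→x with least (between? x) | segMin-spec x
  ... | nothing | none ¬between = ⊥-elim (¬between v (toB (reach-refl v) , toB on-x))
  ... | just i | found .i _ least-between = least-between y (toB on-y , toB y→x)

  segMin-≤ : ∀ {x} → OnPath x → segMin x ≤ x
  segMin-≤ on-x = segMin-least on-x _ on-x (reach-refl _)

  segMin-onPath : ∀ {x} → OnPath x → OnPath (segMin x)
  segMin-onPath on-x = proj₁ (segMin-between on-x)

  segMin-idem : ∀ {x} → OnPath x → segMin (segMin x) ≡ segMin x
  segMin-idem {x} on-x = ≤-antisym (segMin-≤ on-m)
    (segMin-least on-x _ (proj₁ (segMin-between on-m))
      (reach-trans (proj₂ (segMin-between on-m)) (proj₂ (segMin-between on-x))))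
    where
    on-m : OnPath (segMin x)
    on-m = segMin-onPath on-x

  segMin-ltrMin : ∀ {x} → OnPath x → LtrMin (segMin x)
  segMin-ltrMin on-x = toB (segMin-onPath on-x) , segMin-idem on-x

  segMin-parent-≤ : ∀ {x y} → OnPath x → p x ≡ just y → segMin y ≤ segMin x
  segMin-parent-≤ on-x px = segMin-least (reach-trans on-x (reach-step px)) _ (segMin-onPath on-x)
    (reach-trans (proj₂ (segMin-between on-x)) (reach-step px))

  segMin-parent : ∀ {x y} → OnPath x → p x ≡ just y → ¬ LtrMin y → segMin y ≡ segMin x
  segMin-parent {x} {y} on-x px ¬ltr = ≤-antisym (segMin-parent-≤ on-x px) segMin-x≤
    where
    on-y : OnPath y
    on-y = reach-trans on-x (reach-step px)
    segMin-x≤ : segMin x ≤ segMin y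
    segMin-x≤ with ancestors-chain (proj₁ (segMin-between on-y)) on-x
    ... | inj₁ m→x = segMin-least on-x _ (segMin-onPath on-y) m→x
    ... | inj₂ x→m with x ≟ᶠ segMin y
    ...   | yes x≡m = subst (segMin x ≤_) x≡m (segMin-≤ on-x)
    ...   | no x≢m = ⊥-elim (¬ltr (toB on-y ,
              reach-antisym (proj₂ (segMin-between on-y)) (reach-via-parent px x→m x≢m)))

  ltrMin-parent-< : ∀ {x y} → OnPath x → p x ≡ just y → LtrMin y → y < segMin x
  ltrMin-parent-< {x} {y} on-x px ltr
    with m≤n⇒m<n∨m≡n (subst (_≤ segMin x) (proj₂ ltr) (segMin-parent-≤ on-x px))
  ... | inj₁ y<m = y<m
  ... | inj₂ y≡m = ⊥-elim (no-self-loop (subst (λ z → p z ≡ just y) (reach-antisym (reach-step px) y→x) px))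
    where
    y→x : Reach y x
    y→x = subst (λ z → Reach z x) (sym (toℕ-injective y≡m)) (proj₂ (segMin-between on-x))

-- Gluing the cut tree of f at its greatest cycle minimum gives back f.
-- The path from that node to the root runs through the cycles in decreasing
-- order of their minima, each cycle traversed from its minimum onwards; so the
-- ancestors of the marked node are the cyclic points, the segment minima are
-- the cycle minima, and gluing restores the redirected edges.
module GlueCut {n : ℕ} (f : Fin n → Fin n) (x₀ : Fin n)
               (p : ParentFn n) (p≗cut : ∀ x → p x ≡ Cutting.cut f x) where

  open import Data.Nat using (zero; suc; _<?_; z≤n; s≤s)
  import Data.Nat as ℕ
  open import Data.Nat.Properties
    using (<⇒≤; m≤n⇒m<n∨m≡n; ≤-reflexive; ≤-pred) renaming (≤-trans to ℕ-≤-trans)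
  open import Data.Nat.DivMod using (_%_; m%n<n)
  open import Data.Fin using (toℕ; _≤_; _<_; _>_)
  open import Data.Fin.Properties using (toℕ-injective; ≤-antisym; ≤-trans)
  open import Data.Fin.Induction using (>-wellFounded)
  open import Induction.WellFounded using (Acc; acc)
  open import Data.Maybe using (just; nothing)
  open import Data.Product using (_,_; proj₁; proj₂)
  open import Data.Sum using (inj₁; inj₂)
  open import Data.Empty using (⊥-elim)
  open import Relation.Nullary using (yes; no; ¬_)
  open import Relation.Nullary.Decidable using (_×-dec_)
  open import Relation.Binary.PropositionalEquality using (refl; sym; trans; cong; subst)
  open Search

  open Cutting f
  open CutTree p p≗cut

  v : Fin n
  v = lastCycleMin x₀

  open Gluing p v

  climb-along-f : ∀ t y → (∀ s → s ℕ.< t → ¬ IsCycleMin (iter (suc s) y)) →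
    climb p t (just y) ≡ just (iter t y)
  climb-along-f zero y _ = refl
  climb-along-f (suc t) y unvisited =
    trans (cong (climb p t) (trans (p≗cut y) (cut-other (λ closing → unvisited 0 (s≤s z≤n) (proj₂ closing)))))
          (climb-along-f t (f y) (λ s s<t → unvisited (suc s) (s≤s s<t)))

  -- A cyclic node is an ancestor of the minimum of its cycle: x = fᵇ c for
  -- c = cycleMin x, with b below the first return time of c.
  cycle-reachable : ∀ {x} → Cyclic x → Reach (cycleMin x) x
  cycle-reachable {x} cx with cycleMin-attained x | first-return (cycleMin-isCycleMin cx)
  ... | j , c≡ | m , period , first with orbit-returns cx j
  ...   | b , returns = b % suc m , trans
          (climb-along-f (b % suc m) (cycleMin x) (λ s s<b% → first s (ℕ-≤-trans s<b% (≤-pred (m%n<n b (suc m))))))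
          (cong just (trans (sym (iter-mod (suc m) period b)) (trans (cong (iter b) c≡) returns)))

  -- Every cycle minimum is an ancestor of v, by downward induction: the node
  -- closing the cycle of the next cycle minimum above c has parent c.
  cycleMin-reachable : ∀ c → Acc _>_ c → IsCycleMin c → Reach v c
  cycleMin-reachable c (acc above) c-min
    with least (λ y → isCycleMin? y ×-dec (toℕ c <? toℕ y))
       | least-spec (λ y → isCycleMin? y ×-dec (toℕ c <? toℕ y))
  ... | nothing | none ¬above with m≤n⇒m<n∨m≡n (proj₂ (lastCycleMin-spec x₀) c c-min)
  ...   | inj₁ c<v = ⊥-elim (¬above v (proj₁ (lastCycleMin-spec x₀) , c<v))
  ...   | inj₂ c≡v = subst (Reach v) (toℕ-injective (sym c≡v)) (reach-refl v)
  cycleMin-reachable c (acc above) c-min | just c′ | found .c′ (c′-min , c<c′) next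
    with cycle-predecessor (proj₁ c′-min)
  ... | r , cr , f-r = reach-trans (cycleMin-reachable c′ (above c<c′) c′-min)
                         (reach-trans (subst (λ z → Reach z r) cycleMin-r (cycle-reachable cr)) (reach-step p-r))
    where
    cycleMin-r : cycleMin r ≡ c′
    cycleMin-r = trans (sym (cycleMin-f cr)) (trans (cong cycleMin f-r) (proj₂ c′-min))
    p-r : p r ≡ just c
    p-r = trans (p≗cut r) (trans (cut-closing cr (subst IsCycleMin (sym f-r) c′-min))
                                 (trans (cong prevMin f-r) (prevMin-of-next c-min c<c′ next)))

  cyclic⇒reach : ∀ {x} → Cyclic x → Reach v x
  cyclic⇒reach cx = reach-trans (cycleMin-reachable _ (>-wellFounded _) (cycleMin-isCycleMin cx)) (cycle-reachable cx)

  reach⇒cyclic : ∀ {x} → Reach v x → Cyclic x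
  reach⇒cyclic (t , e) = climb-cyclic t (proj₁ (proj₁ (lastCycleMin-spec x₀))) e

  cycleMin-antitone : ∀ {i x} → Cyclic i → Reach i x → cycleMin x ≤ cycleMin i
  cycleMin-antitone ci (t , e) with climb-from-cyclic t ci e
  ... | inj₁ x<i = <⇒≤ x<i
  ... | inj₂ (refl , _) = ≤-reflexive (cong toℕ (cycleMin-orbit ci t))

  cycleMin-between : ∀ {x} → Cyclic x → Between x (cycleMin x)
  cycleMin-between cx = reach⇒reachB cut-acyclic (cyclic⇒reach (proj₁ (cycleMin-isCycleMin cx))) ,
                        reach⇒reachB cut-acyclic (cycle-reachable cx)

  segMin≡cycleMin : ∀ {x} → Cyclic x → segMin x ≡ cycleMin x
  segMin≡cycleMin {x} cx with least (between? x) | segMin-spec x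
  ... | nothing | none ¬between = ⊥-elim (¬between (cycleMin x) (cycleMin-between cx))
  ... | just i | found .i (v→i , i→x) least-between =
    ≤-antisym (least-between (cycleMin x) (cycleMin-between cx))
              (≤-trans (cycleMin-antitone (reach⇒cyclic (reachB⇒reach v→i)) (reachB⇒reach i→x))
                       (cycleMin-≤self i))

  ltrMin⇒isCycleMin : ∀ {y} → LtrMin y → IsCycleMin y
  ltrMin⇒isCycleMin {y} (v→y , segMin≡y) = cy , trans (sym (segMin≡cycleMin cy)) segMin≡y
    where
    cy : Cyclic y
    cy = reach⇒cyclic (reachB⇒reach v→y)

  isCycleMin⇒ltrMin : ∀ {y} → IsCycleMin y → LtrMin y
  isCycleMin⇒ltrMin (cy , cycleMin≡y) =
    reach⇒reachB cut-acyclic (cyclic⇒reach cy) , trans (segMin≡cycleMin cy) cycleMin≡y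

  glue-cut : ∀ x → glue x ≡ f x
  glue-cut x with cyclic? x | isCycleMin? (f x)
  ... | no ¬cx | _ = glue-other (parent-of-noncyclic ¬cx) (λ (v→x , _) → ¬cx (reach⇒cyclic (reachB⇒reach v→x)))
  ... | yes cx | no ¬min =
    glue-other (trans (p≗cut x) (cut-other (λ closing → ¬min (proj₂ closing))))
               (λ (_ , ltr) → ¬min (ltrMin⇒isCycleMin ltr))
  ... | yes cx | yes min =
    trans (glue-closing (reach⇒reachB cut-acyclic (cyclic⇒reach cx)) segment-end)
          (trans (segMin≡cycleMin cx) (sym (isCycleMin-f cx min)))
    where
    p-x : p x ≡ prevMin (f x)
    p-x = trans (p≗cut x) (cut-closing cx min)
    segment-end : SegEnd x
    segment-end with prevMin (f x) in e
    ... | nothing = inj₁ (trans p-x e)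
    ... | just y = inj₂ (y , trans p-x e , isCycleMin⇒ltrMin (proj₁ (prevMin-just e)))

-- The cycles of g are the segments
-- of the path from v to the root, their minima are the segment minima, and
-- cutting redirects each closing edge to the next segment minimum down the path.
module CutGlue {n : ℕ} (p : ParentFn n) (tree : IsCayleyTree p) (v : Fin n)
               (g : Fin n → Fin n) (g≗glue : ∀ x → g x ≡ Gluing.glue p v x) where

  open import Data.Nat using (zero; suc; _+_)
  open import Data.Fin using (_≤_; _<_)
  open import Data.Fin.Properties using (≤-antisym)
  open import Data.Nat.Properties using (<⇒≱)
  open import Data.Maybe using (just; nothing)
  open import Data.Maybe.Properties using (just-injective)
  open import Data.Product using (∃; _×_; _,_; proj₁; proj₂)
  open import Data.Sum using (_⊎_; inj₁; inj₂)
  open import Data.Empty using (⊥-elim)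
  open import Relation.Nullary using (Dec; yes; no; ¬_)
  open import Relation.Binary.PropositionalEquality using (refl; sym; trans; cong; subst)
  open Search

  open SegmentMinima p tree v
  open Cutting g

  glue-cases : ∀ {x} → OnPath x →
    (SegEnd x × g x ≡ segMin x) ⊎ (∃ λ y → p x ≡ just y × ¬ LtrMin y × g x ≡ y)
  glue-cases {x} on-x = cases (p x) refl
    where
    cases : ∀ m → p x ≡ m →
      (SegEnd x × g x ≡ segMin x) ⊎ (∃ λ y → p x ≡ just y × ¬ LtrMin y × g x ≡ y)
    cases nothing px = inj₁ (inj₁ px , trans (g≗glue x) (glue-closing (toB on-x) (inj₁ px)))
    cases (just y) px with ltrMin? y
    ... | yes ltr = inj₁ (inj₂ (y , px , ltr) , trans (g≗glue x) (glue-closing (toB on-x) (inj₂ (y , px , ltr))))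
    ... | no ¬ltr = inj₂ (y , px , ¬ltr , trans (g≗glue x) (glue-other px (λ closing → ¬ltr (proj₂ closing))))

  glue-offPath : ∀ {x} → ¬ OnPath x → p x ≡ just (g x)
  glue-offPath {x} off with p x in px
  ... | nothing = ⊥-elim (off (subst OnPath (sym (root-unique x px)) (reach-root v)))
  ... | just y = cong just (sym (trans (g≗glue x) (glue-other px (λ closing → off (reachB⇒reach (proj₁ closing))))))

  onPath-closed : ∀ {x} → OnPath x → OnPath (g x)
  onPath-closed on-x with glue-cases on-x
  ... | inj₁ (_ , gx≡) = subst OnPath (sym gx≡) (segMin-onPath on-x)
  ... | inj₂ (_ , px , _ , gx≡) = subst OnPath (sym gx≡) (reach-trans on-x (reach-step px))

  onPath-iter : ∀ t {x} → OnPath x → OnPath (iter t x)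
  onPath-iter zero on-x = on-x
  onPath-iter (suc t) on-x = onPath-iter t (onPath-closed on-x)

  iter-until-path : ∀ t x → OnPath (iter t x) ⊎ climb p t (just x) ≡ just (iter t x)
  iter-until-path zero x = inj₂ refl
  iter-until-path (suc t) x with reachB? v x
  ... | yes v→x = inj₁ (onPath-iter (suc t) (reachB⇒reach v→x))
  ... | no off with iter-until-path t (g x)
  ...   | inj₁ on = inj₁ on
  ...   | inj₂ e = inj₂ (trans (cong (climb p t) (glue-offPath (λ on → off (toB on)))) e)

  cyclic⇒onPath : ∀ {x} → Cyclic x → OnPath x
  cyclic⇒onPath {x} (k , period) with iter-until-path (suc k) x
  ... | inj₁ on = subst OnPath period on
  ... | inj₂ e = ⊥-elim (no-cycle x k (trans e (cong just period)))

  Segment : Fin n → Fin n → Set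
  Segment c y = OnPath y × segMin y ≡ c

  segment-closed : ∀ {c y} → Segment c y → Segment c (g y)
  segment-closed {c} {y} (on-y , m≡c) with glue-cases on-y
  ... | inj₁ (_ , gy≡) = subst (Segment c) (sym gy≡) (segMin-onPath on-y , trans (segMin-idem on-y) m≡c)
  ... | inj₂ (_ , py , ¬ltr , gy≡) =
    subst (Segment c) (sym gy≡) (reach-trans on-y (reach-step py) , trans (segMin-parent on-y py ¬ltr) m≡c)

  segment-iter : ∀ {c y} → Segment c y → ∀ t → Segment c (iter t y)
  segment-iter s zero = s
  segment-iter s (suc t) = segment-iter (segment-closed s) t

  segment-returns : ∀ k {c y} → Segment c y → climb p k (just y) ≡ just root → ∃ λ a → iter (suc a) y ≡ c
  segment-returns k {c} {y} (on-y , m≡c) y→root with glue-cases on-y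
  ... | inj₁ (_ , gy≡) = 0 , trans gy≡ m≡c
  ... | inj₂ (_ , py , _ , gy≡) with k
  ...   | zero with () ← trans (sym py) (subst (λ z → p z ≡ nothing) (sym (just-injective y→root)) root-parent)
  ...   | suc k′ with segment-returns k′ (segment-closed (on-y , m≡c))
                        (trans (cong (climb p k′) (trans (cong just gy≡) (sym py))) y→root)
  ...     | a , e = suc a , e

  segment-follows-parent : ∀ k {x y} → OnPath x → Reach (segMin x) y →
    climb p k (just y) ≡ just x → iter k y ≡ x
  segment-follows-parent zero _ _ y→x = just-injective y→x
  segment-follows-parent (suc k) {x} {y} on-x m→y y→x with glue-cases (reach-trans (segMin-onPath on-x) m→y)
  ... | inj₂ (_ , py , _ , gy≡) = subst (λ z → iter k z ≡ x) (sym gy≡)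
        (segment-follows-parent k on-x (reach-trans m→y (reach-step py)) (trans (cong (climb p k) (sym py)) y→x))
  ... | inj₁ (inj₁ py , _) with () ← trans (sym y→x) (trans (cong (climb p k) py) (climb-nothing k))
  ... | inj₁ (inj₂ (y′ , py , ltr) , _) = ⊥-elim (no-self-loop (subst (λ z → p y ≡ just z) (sym y≡y′) py))
    -- the parent y′ of y would be a left-to-right minimum between segMin x
    -- and x, hence segMin x itself, making y = y′ a fixed point of p
    where
    on-y′ : OnPath y′
    on-y′ = reach-trans (reach-trans (segMin-onPath on-x) m→y) (reach-step py)
    y′≡m : y′ ≡ segMin x
    y′≡m = ≤-antisym
      (subst (_≤ segMin x) (proj₂ ltr)
        (segMin-least on-y′ (segMin x) (segMin-onPath on-x) (reach-trans m→y (reach-step py))))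
      (segMin-least on-x y′ on-y′ (k , trans (cong (climb p k) (sym py)) y→x))
    y≡y′ : y ≡ y′
    y≡y′ = trans (reach-antisym (subst (Reach y) y′≡m (reach-step py)) m→y) (sym y′≡m)

  onPath⇒cyclic : ∀ {x} → OnPath x → Cyclic x
  onPath⇒cyclic {x} on-x with reach-root x
  ... | k , x→root with segment-returns k (on-x , refl) x→root | proj₂ (segMin-between on-x)
  ...   | a , returns | b , m→x = a + b , (begin
    iter (suc a + b) x          ≡⟨ iter-+ (suc a) b x ⟩
    iter b (iter (suc a) x)     ≡⟨ cong (iter b) returns ⟩
    iter b (segMin x)           ≡⟨ segment-follows-parent b on-x (reach-refl (segMin x)) m→x ⟩
    x                           ∎)
    where open Relation.Binary.PropositionalEquality.≡-Reasoning

  cycleMin≡segMin : ∀ {x} → OnPath x → cycleMin x ≡ segMin x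
  cycleMin≡segMin {x} on-x with reach-root x
  ... | k , x→root with segment-returns k (on-x , refl) x→root
  ...   | a , returns = sym (cycleMin-unique {a = suc a} (onPath⇒cyclic on-x) (sym returns)
          (λ j → let (on-j , m≡) = segment-iter (on-x , refl) j in subst (_≤ iter j x) m≡ (segMin-≤ on-j)))

  isCycleMin⇒ltrMin : ∀ {y} → IsCycleMin y → LtrMin y
  isCycleMin⇒ltrMin (cy , cycleMin≡y) = toB on-y , trans (sym (cycleMin≡segMin on-y)) cycleMin≡y
    where
    on-y : OnPath _
    on-y = cyclic⇒onPath cy

  ltrMin⇒isCycleMin : ∀ {y} → LtrMin y → IsCycleMin y
  ltrMin⇒isCycleMin (v→y , segMin≡y) = onPath⇒cyclic on-y , trans (cycleMin≡segMin on-y) segMin≡y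
    where
    on-y : OnPath _
    on-y = reachB⇒reach v→y

  lastCycleMin≡v : ∀ x₀ → lastCycleMin x₀ ≡ v
  lastCycleMin≡v x₀ = ≤-antisym
    (subst (_≤ v) (proj₂ ltr) (segMin-least on-t v (reach-refl v) on-t))
    (proj₂ (lastCycleMin-spec x₀) v (ltrMin⇒isCycleMin v-ltrMin))
    where
    ltr : LtrMin (lastCycleMin x₀)
    ltr = isCycleMin⇒ltrMin (proj₁ (lastCycleMin-spec x₀))
    on-t : OnPath (lastCycleMin x₀)
    on-t = reachB⇒reach (proj₁ ltr)
    v-ltrMin : LtrMin v
    v-ltrMin = toB (reach-refl v) ,
      reach-antisym (proj₂ (segMin-between (reach-refl v))) (proj₁ (segMin-between (reach-refl v)))

  ltrMin-below⇒ancestor : ∀ {x z} → OnPath x → LtrMin z → z < segMin x → Reach x z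
  ltrMin-below⇒ancestor on-x ltr z<m with ancestors-chain on-x (reachB⇒reach (proj₁ ltr))
  ... | inj₁ x→z = x→z
  ... | inj₂ z→x = ⊥-elim (<⇒≱ z<m (segMin-least on-x _ (reachB⇒reach (proj₁ ltr)) z→x))

  prevMin-at-root : ∀ {x} → OnPath x → p x ≡ nothing → prevMin (segMin x) ≡ p x
  prevMin-at-root {x} on-x px with prevMin (segMin x) | prevMin-spec (segMin x)
  ... | nothing | _ = sym px
  ... | just i | found .i (i-min , i<m) _ =
    ⊥-elim (<⇒≱ i<m (segMin-least on-x i (reachB⇒reach (proj₁ ltr)) (subst (λ z → Reach z x) (sym i≡x) (reach-refl x))))
    -- a cycle minimum i below segMin x would be an ancestor of the root x
    where
    ltr : LtrMin i
    ltr = isCycleMin⇒ltrMin i-min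
    x≡root : x ≡ root
    x≡root = root-unique x px
    i≡x : i ≡ x
    i≡x = trans (root-maximal (subst (λ z → Reach z i) x≡root (ltrMin-below⇒ancestor on-x ltr i<m))) (sym x≡root)

  prevMin-at-ltrMin : ∀ {x y} → OnPath x → p x ≡ just y → LtrMin y → prevMin (segMin x) ≡ p x
  prevMin-at-ltrMin {x} {y} on-x px ltr with prevMin (segMin x) | prevMin-spec (segMin x)
  ... | nothing | none ¬below = ⊥-elim (¬below y (ltrMin⇒isCycleMin ltr , ltrMin-parent-< on-x px ltr))
  ... | just i | found .i (i-min , i<m) greatest =
    trans (cong just (≤-antisym i≤y (greatest y (ltrMin⇒isCycleMin ltr , ltrMin-parent-< on-x px ltr)))) (sym px)
    where
    ltr-i : LtrMin i
    ltr-i = isCycleMin⇒ltrMin i-min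
    x→i : Reach x i
    x→i = ltrMin-below⇒ancestor on-x ltr-i i<m
    x≢i : x Relation.Binary.PropositionalEquality.≢ i
    x≢i x≡i = <⇒≱ i<m
      (segMin-least on-x i (reachB⇒reach (proj₁ ltr-i)) (subst (Reach i) (sym x≡i) (reach-refl i)))
    i≤y : i ≤ y
    i≤y = subst (_≤ y) (proj₂ ltr-i)
      (segMin-least (reachB⇒reach (proj₁ ltr-i)) y (reach-trans on-x (reach-step px)) (reach-via-parent px x→i x≢i))

  cut-glue : ∀ x → cut x ≡ p x
  cut-glue x = by-cases (cyclic? x) (isCycleMin? (g x))
    where
    -- (a plain case split, leaving the case analysis inside cut unabstracted)
    by-cases : Dec (Cyclic x) → Dec (IsCycleMin (g x)) → cut x ≡ p x
    by-cases (no ¬cx) _ =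
      trans (cut-other (λ closing → ¬cx (proj₁ closing))) (sym (glue-offPath (λ on → ¬cx (onPath⇒cyclic on))))
    by-cases (yes cx) (no ¬min) with glue-cases (cyclic⇒onPath cx)
    ... | inj₁ (_ , gx≡) =
      ⊥-elim (¬min (subst IsCycleMin (sym gx≡) (ltrMin⇒isCycleMin (segMin-ltrMin (cyclic⇒onPath cx)))))
    ... | inj₂ (_ , px , _ , gx≡) =
      trans (cut-other (λ closing → ¬min (proj₂ closing))) (trans (cong just gx≡) (sym px))
    by-cases (yes cx) (yes min) with glue-cases (cyclic⇒onPath cx)
    ... | inj₂ (_ , _ , ¬ltr , gx≡) = ⊥-elim (¬ltr (subst LtrMin gx≡ (isCycleMin⇒ltrMin min)))
    ... | inj₁ (inj₁ px , gx≡) =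
      trans (cut-closing cx min) (trans (cong prevMin gx≡) (prevMin-at-root (cyclic⇒onPath cx) px))
    ... | inj₁ (inj₂ (_ , px , ltr) , gx≡) =
      trans (cut-closing cx min) (trans (cong prevMin gx≡) (prevMin-at-ltrMin (cyclic⇒onPath cx) px ltr))

module Bijection (n′ m : ℕ) where

  open import Data.Nat using (suc; _≟_)
  open import Data.Fin using (zero)
  open import Data.Maybe using (Maybe)
  open import Data.Vec using (Vec; lookup; tabulate)
  open import Data.Vec.Properties using (lookup∘tabulate; tabulate∘lookup; tabulate-cong)
  open import Data.List using (List; filter; length; allFin; cartesianProduct)
  open import Data.List.Properties using (length-tabulate)
  open import Data.List.Membership.Propositional using (_∈_)
  open import Data.List.Membership.Propositional.Properties
    using (∈-allFin; ∈-filter⁺; ∈-filter⁻; ∈-cartesianProduct⁺; ∈-cartesianProduct⁻)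
  import Data.List.Relation.Unary.Unique.Propositional.Properties as Unique
  open import Data.List.Relation.Binary.Pointwise as Pointwise using (Pointwise-length)
  open import Data.Product using (_×_; _,_; proj₁; proj₂)
  open import Relation.Nullary using (Dec)
  open import Relation.Binary.PropositionalEquality using (refl; sym; trans; cong₂)
  open Counting using (filter-bijection-length; length-cartesianProduct)
  open Enumeration
  open Congruence

  N : ℕ
  N = suc n′

  MappingVec : Set
  MappingVec = Vec (Fin N) N

  TreeVec : Set
  TreeVec = Vec (Maybe (Fin N)) N

  mappingVecs : List MappingVec
  mappingVecs = allVecs (allFin N) N

  hasRuns? : (f : MappingVec) → Dec (runsM (lookup f) ≡ m)
  hasRuns? f = runsM (lookup f) ≟ m

  treeVecs : List TreeVec
  treeVecs = filter (λ w → runsT (lookup w) ≟ m)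
                    (filter (λ w → isCayleyTree? (lookup w)) (allVecs (parentChoices N) N))

  markedTrees : List (Fin N × TreeVec)
  markedTrees = cartesianProduct (allFin N) treeVecs

  ∈-treeVecs⁻ : ∀ {w} → w ∈ treeVecs → IsCayleyTree (lookup w) × runsT (lookup w) ≡ m
  ∈-treeVecs⁻ w∈ = let (w∈′ , runs) = ∈-filter⁻ (λ w → runsT (lookup w) ≟ m) w∈ in
    proj₂ (∈-filter⁻ (λ w → isCayleyTree? (lookup w)) {xs = allVecs (parentChoices N) N} w∈′) , runs

  ∈-treeVecs⁺ : ∀ {w} → IsCayleyTree (lookup w) → runsT (lookup w) ≡ m → w ∈ treeVecs
  ∈-treeVecs⁺ tree runs = ∈-filter⁺ _ (∈-filter⁺ _ (allVecs-complete parentChoices-complete _) tree) runs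

  cutV : MappingVec → Fin N × TreeVec
  cutV f = Orbits.lastCycleMin (lookup f) zero , tabulate (Cutting.cut (lookup f))

  glueV : Fin N × TreeVec → MappingVec
  glueV (v , w) = tabulate (Gluing.glue (lookup w) v)

  cutV∈ : ∀ {f} → runsM (lookup f) ≡ m → cutV f ∈ markedTrees
  cutV∈ {f} runs =
    ∈-cartesianProduct⁺ (∈-allFin _) (∈-treeVecs⁺ (cut-isTree zero) (trans (sym runs-cut) runs))
    where
    open Cutting.CutTree (lookup f) (lookup (tabulate (Cutting.cut (lookup f))))
                                    (lookup∘tabulate (Cutting.cut (lookup f)))

  glueV-runs : ∀ {b} → b ∈ markedTrees → runsM (lookup (glueV b)) ≡ m
  glueV-runs {v , w} b∈ = trans runs-cut (trans (runsT-cong cut-glue) (proj₂ (∈-treeVecs⁻ w∈)))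
    where
    w∈ : w ∈ treeVecs
    w∈ = proj₂ (∈-cartesianProduct⁻ (allFin N) treeVecs b∈)
    g : Mapping N
    g = lookup (glueV (v , w))
    open Cutting.CutTree g (Cutting.cut g) (λ _ → refl)
    open CutGlue (lookup w) (proj₁ (∈-treeVecs⁻ w∈)) v g (lookup∘tabulate (Gluing.glue (lookup w) v))

  glueV∘cutV : ∀ f → glueV (cutV f) ≡ f
  glueV∘cutV f =
    trans (tabulate-cong (GlueCut.glue-cut (lookup f) zero (lookup (tabulate cut)) (lookup∘tabulate cut)))
          (tabulate∘lookup f)
    where
    cut : ParentFn N
    cut = Cutting.cut (lookup f)

  cutV∘glueV : ∀ {b} → b ∈ markedTrees → cutV (glueV b) ≡ b
  cutV∘glueV {v , w} b∈ =
    cong₂ _,_ (lastCycleMin≡v zero) (trans (tabulate-cong cut-glue) (tabulate∘lookup w))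
    where
    w∈ : w ∈ treeVecs
    w∈ = proj₂ (∈-cartesianProduct⁻ (allFin N) treeVecs b∈)
    open CutGlue (lookup w) (proj₁ (∈-treeVecs⁻ w∈)) v (lookup (glueV (v , w)))
                 (lookup∘tabulate (Gluing.glue (lookup w) v))

  mappings-markedTrees : length (filter hasRuns? mappingVecs) ≡ length markedTrees
  mappings-markedTrees = filter-bijection-length hasRuns?
    (allVecs-unique (Unique.allFin⁺ N) N) (allVecs-complete ∈-allFin)
    (Unique.cartesianProduct⁺ (Unique.allFin⁺ N)
      (Unique.filter⁺ _ (Unique.filter⁺ _ (allVecs-unique (parentChoices-unique N) N))))
    cutV glueV (λ {f} → cutV∈ {f}) (λ {b} → glueV-runs {b})
    (λ {f} _ → glueV∘cutV f) (λ {b} → cutV∘glueV {b})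

  R≡ : R N m ≡ length (filter hasRuns? mappingVecs)
  R≡ = Pointwise-length (Pointwise.filter⁺ (λ f → runsM f ≟ m) hasRuns?
    (λ f≗v runs → trans (sym (runsM-cong f≗v)) runs) (λ f≗v runs → trans (runsM-cong f≗v) runs)
    (allFuns≗allVecs (allFin N) N))

  F≡ : F N m ≡ length treeVecs
  F≡ = Pointwise-length (Pointwise.filter⁺ (λ p → runsT p ≟ m) (λ w → runsT (lookup w) ≟ m)
    (λ p≗w runs → trans (sym (runsT-cong p≗w)) runs) (λ p≗w runs → trans (runsT-cong p≗w) runs)
    (Pointwise.filter⁺ isCayleyTree? (λ w → isCayleyTree? (lookup w))
      (λ p≗w → isCayleyTree-cong p≗w) (λ p≗w → isCayleyTree-cong (λ x → sym (p≗w x)))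
      (allFuns≗allVecs (parentChoices N) N)))

  count : R N m ≡ N * F N m
  count = begin
    R N m                                   ≡⟨ R≡ ⟩
    length (filter hasRuns? mappingVecs)    ≡⟨ mappings-markedTrees ⟩
    length markedTrees                      ≡⟨ length-cartesianProduct (allFin N) treeVecs ⟩
    length (allFin N) * length treeVecs     ≡⟨ cong₂ _*_ (length-tabulate {n = N} (λ i → i)) (sym F≡) ⟩
    N * F N m                               ∎
    where open Relation.Binary.PropositionalEquality.≡-Reasoning

mainTheorem2 : (n m : ℕ) → n ≥ 1 → m ≥ 1 → R n m ≡ n * F n m
mainTheorem2 (suc n′) m _ _ = Bijection.count n′ m
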